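{- Let $G$ be a connected graph with no subgraph isomorphic to $Y$, and let $P=v_0v_1\dots v_\ell$ be a longest path in $G$, chosen subject to that to minimize $\deg(v_0)+\deg(v_\ell)$, with $\ell\ge5$. Let $L_i=N_G(v_i)\setminus V(P)$. Assume $G$ has no edge $v_av_b$ with $a\in\{0,1\}$, $b\in\{\ell-1,\ell\}$, and $L_1\cap L_{\ell-1}=\emptyset$. If $v_0v_3\in E(G)$, then $L_0=L_2=\emptyset$ and $L_1\subseteq L_3$. Similarly, if $v_{\ell-3}v_\ell\in E(G)$, then $L_{\ell-2}=L_\ell=\emptyset$ and $L_{\ell-1}\subseteq L_{\ell-3}$.
   Context: All graphs are finite and simple. $Y$ is the 7-vertex tree obtained from $K_{1,3}$ by subdividing each edge exactly once. -}

module Defs where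

open import Data.Nat using (ℕ; zero; suc; _+_; _≤_; _<_; _∸_)
open import Data.Fin using (Fin)
open import Data.Bool using (Bool; true; false; if_then_else_)
open import Data.List using (List; map; allFin)
open import Data.Nat.ListAction using (sum)
open import Data.Product using (Σ; _×_; ∃)
open import Relation.Binary.PropositionalEquality using (_≡_; _≢_)
open import Relation.Nullary using (¬_)

record Graph (n : ℕ) : Set where
  field
    adj   : Fin n → Fin n → Bool
    sym   : ∀ u v → adj u v ≡ adj v u
    irref : ∀ v → adj v v ≡ false
open Graph public

Edge : ∀ {n} → Graph n → Fin n → Fin n → Set
Edge G u v = adj G u v ≡ true

deg : ∀ {n} → Graph n → Fin n → ℕ
deg {n} G v = sum (map (λ u → if adj G v u then 1 else 0) (allFin n))

-- A path v_0 v_1 ... v_len in G (len = number of edges); the vertex map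
-- is indexed by ℕ and only its values at indices 0..len matter.
record Path {n : ℕ} (G : Graph n) : Set where
  field
    len  : ℕ
    vx   : ℕ → Fin n
    step : ∀ i → i < len → Edge G (vx i) (vx (suc i))
    inj  : ∀ i j → i ≤ len → j ≤ len → vx i ≡ vx j → i ≡ j
open Path public

OnPath : ∀ {n} {G : Graph n} → Path G → Fin n → Set
OnPath P x = Σ ℕ λ i → i ≤ len P × vx P i ≡ x

Connected : ∀ {n} → Graph n → Set
Connected G = ∀ u v → Σ (Path G) λ Q → vx Q 0 ≡ u × vx Q (len Q) ≡ v

-- The tree Y: K_{1,3} with each edge subdivided once.
-- Vertices: 0 = centre, 1,2,3 = middle vertices, 4,5,6 = leaves,
-- edges 0-1, 0-2, 0-3, 1-4, 2-5, 3-6.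
-- G contains a (not necessarily induced) subgraph isomorphic to Y.
HasYSubgraph : ∀ {n} → Graph n → Set
HasYSubgraph {n} G =
  Σ (Fin 7 → Fin n) λ f →
    (∀ i j → f i ≡ f j → i ≡ j) ×
    Edge G (f Fin.zero) (f (Fin.suc Fin.zero)) ×
    Edge G (f Fin.zero) (f (Fin.suc (Fin.suc Fin.zero))) ×
    Edge G (f Fin.zero) (f (Fin.suc (Fin.suc (Fin.suc Fin.zero)))) ×
    Edge G (f (Fin.suc Fin.zero)) (f (Fin.suc (Fin.suc (Fin.suc (Fin.suc Fin.zero))))) ×
    Edge G (f (Fin.suc (Fin.suc Fin.zero))) (f (Fin.suc (Fin.suc (Fin.suc (Fin.suc (Fin.suc Fin.zero)))))) ×
    Edge G (f (Fin.suc (Fin.suc (Fin.suc Fin.zero)))) (f (Fin.suc (Fin.suc (Fin.suc (Fin.suc (Fin.suc (Fin.suc Fin.zero)))))))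

InL : ∀ {n} {G : Graph n} → Path G → ℕ → Fin n → Set
InL {G = G} P i x = Edge G (vx P i) x × ¬ OnPath P x

ChosenPath : ∀ {n} (G : Graph n) → Path G → Set
ChosenPath G P =
  (∀ (Q : Path G) → len Q ≤ len P) ×
  (∀ (Q : Path G) → len Q ≡ len P →
     deg G (vx P 0) + deg G (vx P (len P)) ≤ deg G (vx Q 0) + deg G (vx Q (len Q)))

-- With the chord v₀v₃, reversing the segment v₀v₁v₂ of P gives the longest path
-- v₂v₁v₀v₃…v_ℓ, and replacing its start by x ∈ L₁ gives the longest path x v₁v₀v₃…v_ℓ.
-- A longest path contains every neighbour of its start vertex, so L₀ and L₂ are empty and
-- every neighbour of x is one of v₁, v₀, v₃, …, v_ℓ. By the choice of P, deg x ≥ deg v₀ ≥ 2,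
-- so x has a neighbour v_j ≠ v₁. Now j = 0 is excluded by L₀ = ∅, j = ℓ because P is
-- longest, j = ℓ - 1 by L₁ ∩ L_{ℓ-1} = ∅, and 4 ≤ j ≤ ℓ - 2 because v_j, its path
-- neighbourhood and x v₁ would form a copy of Y. Hence j = 3. The second half is the
-- first one for the reversed path.
module Submission where

open import Defs hiding (sym)
open import Data.Bool using (T; true; false; if_then_else_) renaming (_≟_ to _≟ᵇ_)
open import Data.Empty using (⊥-elim)
open import Data.Fin using (Fin) renaming (zero to f0; suc to fs)
import Data.Fin.Properties as Fin
open import Data.List using (tabulate)
open import Data.List.Properties using (map-tabulate)
open import Data.Nat
  using (ℕ; zero; suc; _+_; _≤_; _<_; _∸_; _≤ᵇ_; z≤n; s≤s; s≤s⁻¹; _≟_; _≤?_; anyUpTo?)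
open import Data.Nat.ListAction using (sum)
open import Data.Nat.Properties
  using ( ≤-refl; ≤-trans; ≤-antisym; ≤-pred; <⇒≤; <⇒≱; ≰⇒>; ≤∧≢⇒<; <-cmp; 1+n≰n
        ; m<n⇒m<1+n; ≤ᵇ⇒≤; ≤⇒≤ᵇ; +-mono-≤; +-cancelʳ-≤; +-comm; +-identityʳ
        ; m≤m+n; m≤n+m; m∸n≤m; m∸[m∸n]≡n; m+n∸n≡m; n∸n≡0; +-∸-assoc)
open import Data.Product using (∃-syntax; _×_; _,_; proj₁)
open import Function using (_∘_)
open import Relation.Binary using (tri<; tri≈; tri>)
open import Relation.Binary.PropositionalEquality
  using (_≡_; _≢_; refl; sym; trans; cong; subst; module ≡-Reasoning)
open import Relation.Nullary using (¬_; ¬?; Dec; yes; no)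
open import Relation.Nullary.Decidable using (map′; decidable-stable; _×-dec_)

module _ {n} (G : Graph n) where

  Edge-sym : ∀ {u v} → Edge G u v → Edge G v u
  Edge-sym {u} {v} e = trans (Graph.sym G v u) e

  Edge-irrefl : ∀ {u} → ¬ Edge G u u
  Edge-irrefl {u} e with () ← trans (sym e) (irref G u)

sum-tabulate-zero : ∀ {m} (f : Fin m → ℕ) → (∀ u → f u ≡ 0) → sum (tabulate f) ≡ 0
sum-tabulate-zero {zero}  f f≡0 = refl
sum-tabulate-zero {suc m} f f≡0 rewrite f≡0 f0 = sum-tabulate-zero (f ∘ fs) (f≡0 ∘ fs)

sum-tabulate-supported : ∀ {m} (f : Fin m → ℕ) a → (∀ u → u ≢ a → f u ≡ 0) → sum (tabulate f) ≡ f a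
sum-tabulate-supported f f0 f≡0
  rewrite sum-tabulate-zero (f ∘ fs) (λ u → f≡0 (fs u) λ ()) = +-identityʳ (f f0)
sum-tabulate-supported f (fs a) f≡0 rewrite f≡0 f0 λ () =
  sum-tabulate-supported (f ∘ fs) a (λ u u≢a → f≡0 (fs u) (u≢a ∘ Fin.suc-injective))

sum-tabulate-≥ : ∀ {m} (f : Fin m → ℕ) a → f a ≤ sum (tabulate f)
sum-tabulate-≥ f f0     = m≤m+n (f f0) _
sum-tabulate-≥ f (fs a) = ≤-trans (sum-tabulate-≥ (f ∘ fs) a) (m≤n+m _ (f f0))

sum-tabulate-≥₂ : ∀ {m} (f : Fin m → ℕ) {a b} → a ≢ b → 1 ≤ f a → 1 ≤ f b → 2 ≤ sum (tabulate f)
sum-tabulate-≥₂ f {f0}   {f0}   a≢b _ _ = ⊥-elim (a≢b refl)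
sum-tabulate-≥₂ f {f0}   {fs b} _ 1≤fa 1≤fb = +-mono-≤ 1≤fa (≤-trans 1≤fb (sum-tabulate-≥ (f ∘ fs) b))
sum-tabulate-≥₂ f {fs a} {f0}   _ 1≤fa 1≤fb = +-mono-≤ 1≤fb (≤-trans 1≤fa (sum-tabulate-≥ (f ∘ fs) a))
sum-tabulate-≥₂ f {fs a} {fs b} a≢b 1≤fa 1≤fb =
  ≤-trans (sum-tabulate-≥₂ (f ∘ fs) (a≢b ∘ cong fs) 1≤fa 1≤fb) (m≤n+m _ (f f0))

module _ {n} (G : Graph n) where

  incidence : Fin n → Fin n → ℕ
  incidence v u = if adj G v u then 1 else 0

  deg≡sum-incidence : ∀ v → deg G v ≡ sum (tabulate (incidence v))
  deg≡sum-incidence v = cong sum (map-tabulate (λ u → u) (incidence v))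

  incidence-edge : ∀ {v u} → Edge G v u → 1 ≤ incidence v u
  incidence-edge e rewrite e = s≤s z≤n

  incidence-nonedge : ∀ {v u} → ¬ Edge G v u → incidence v u ≡ 0
  incidence-nonedge {v} {u} ¬e with adj G v u
  ... | true  = ⊥-elim (¬e refl)
  ... | false = refl

  incidence≤1 : ∀ v u → incidence v u ≤ 1
  incidence≤1 v u with adj G v u
  ... | true  = ≤-refl
  ... | false = z≤n

  2≤deg : ∀ {v a b} → Edge G v a → Edge G v b → a ≢ b → 2 ≤ deg G v
  2≤deg {v} v~a v~b a≢b rewrite deg≡sum-incidence v =
    sum-tabulate-≥₂ (incidence v) a≢b (incidence-edge v~a) (incidence-edge v~b)

  2≤deg⇒neighbour≢ : ∀ v → 2 ≤ deg G v → ∀ a → ∃[ u ] Edge G v u × u ≢ a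
  2≤deg⇒neighbour≢ v 2≤deg a with Fin.any? (λ u → adj G v u ≟ᵇ true ×-dec ¬? (u Fin.≟ a))
  ... | yes found = found
  ... | no  none  = ⊥-elim (<⇒≱ 2≤deg (subst (_≤ 1) (sym (deg≡sum-incidence v)) sum≤1))
    where
      sum≤1 : sum (tabulate (incidence v)) ≤ 1
      sum≤1 rewrite sum-tabulate-supported (incidence v) a
                      (λ u u≢a → incidence-nonedge (λ e → none (u , e , u≢a))) = incidence≤1 v a

record IndexInvolution (ℓ : ℕ) : Set where
  field
    σ          : ℕ → ℕ
    bounded    : ∀ {i} → i ≤ ℓ → σ i ≤ ℓ
    involutive : ∀ {i} → i ≤ ℓ → σ (σ i) ≡ i
open IndexInvolution

reverseIndex : ∀ ℓ → IndexInvolution ℓ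
reverseIndex ℓ = record { σ = ℓ ∸_ ; bounded = λ {i} _ → m∸n≤m ℓ i ; involutive = m∸[m∸n]≡n }

flipPrefix : ℕ → ℕ → ℕ
flipPrefix k i = if i ≤ᵇ k then k ∸ i else i

flipPrefix-≤ : ∀ {k i} → i ≤ k → flipPrefix k i ≡ k ∸ i
flipPrefix-≤ {k} {i} i≤k with i ≤ᵇ k | ≤⇒≤ᵇ i≤k
... | true | _ = refl

flipPrefix-> : ∀ {k i} → k < i → flipPrefix k i ≡ i
flipPrefix-> {k} {i} k<i with i ≤ᵇ k | ≤ᵇ⇒≤ i k
... | false | _   = refl
... | true  | i≤k = ⊥-elim (<⇒≱ k<i (i≤k _))

flipPrefixIndex : ∀ {ℓ} k → k ≤ ℓ → IndexInvolution ℓ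
flipPrefixIndex {ℓ} k k≤ℓ = record { σ = flipPrefix k ; bounded = bounded′ ; involutive = involutive′ }
  where
    bounded′ : ∀ {i} → i ≤ ℓ → flipPrefix k i ≤ ℓ
    bounded′ {i} i≤ℓ with i ≤? k
    ... | yes i≤k rewrite flipPrefix-≤ i≤k = ≤-trans (m∸n≤m k i) k≤ℓ
    ... | no  i≰k rewrite flipPrefix-> (≰⇒> i≰k) = i≤ℓ
    involutive′ : ∀ {i} → i ≤ ℓ → flipPrefix k (flipPrefix k i) ≡ i
    involutive′ {i} _ with i ≤? k
    ... | yes i≤k rewrite flipPrefix-≤ i≤k | flipPrefix-≤ (m∸n≤m k i) = m∸[m∸n]≡n i≤k
    ... | no  i≰k rewrite flipPrefix-> (≰⇒> i≰k) = flipPrefix-> (≰⇒> i≰k)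

module _ {n} {G : Graph n} where

  Longest : Path G → Set
  Longest P = ∀ (Q : Path G) → len Q ≤ len P

  onPath? : (P : Path G) → ∀ x → Dec (OnPath P x)
  onPath? P x = map′ (λ (i , i<1+ℓ , eq) → i , s≤s⁻¹ i<1+ℓ , eq)
                     (λ (i , i≤ℓ , eq) → i , s≤s i≤ℓ , eq)
                     (anyUpTo? (λ i → vx P i Fin.≟ x) (suc (len P)))

  step-backward : (P : Path G) → ∀ {k i} → i < k → k ≤ len P → Edge G (vx P (k ∸ i)) (vx P (k ∸ suc i))
  step-backward P {k} {i} i<k k≤ℓ =
    subst (λ j → Edge G (vx P j) (vx P (k ∸ suc i))) (sym k∸i≡1+k∸[1+i])
      (Edge-sym G (step P (k ∸ suc i) (≤-trans (subst (_≤ k) k∸i≡1+k∸[1+i] (m∸n≤m k i)) k≤ℓ)))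
    where
      k∸i≡1+k∸[1+i] : k ∸ i ≡ suc (k ∸ suc i)
      k∸i≡1+k∸[1+i] = +-∸-assoc 1 i<k

  reindex : (P : Path G) (ι : IndexInvolution (len P)) →
            (∀ i → i < len P → Edge G (vx P (σ ι i)) (vx P (σ ι (suc i)))) → Path G
  reindex P ι steps = record
    { len  = len P
    ; vx   = vx P ∘ σ ι
    ; step = steps
    ; inj  = λ i j i≤ℓ j≤ℓ eq → begin
        i             ≡⟨ sym (involutive ι i≤ℓ) ⟩
        σ ι (σ ι i)   ≡⟨ cong (σ ι) (inj P _ _ (bounded ι i≤ℓ) (bounded ι j≤ℓ) eq) ⟩
        σ ι (σ ι j)   ≡⟨ involutive ι j≤ℓ ⟩
        j             ∎
    }
    where open ≡-Reasoning

  module _ (P : Path G) (ι : IndexInvolution (len P))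
           (steps : ∀ i → i < len P → Edge G (vx P (σ ι i)) (vx P (σ ι (suc i)))) where

    onPath-reindex⁻ : ∀ {x} → OnPath (reindex P ι steps) x → OnPath P x
    onPath-reindex⁻ (i , i≤ℓ , eq) = σ ι i , bounded ι i≤ℓ , eq

    onPath-reindex⁺ : ∀ {x} → OnPath P x → OnPath (reindex P ι steps) x
    onPath-reindex⁺ (i , i≤ℓ , eq) = σ ι i , bounded ι i≤ℓ , trans (cong (vx P) (involutive ι i≤ℓ)) eq

  reverse-step : (P : Path G) → ∀ i → i < len P → Edge G (vx P (len P ∸ i)) (vx P (len P ∸ suc i))
  reverse-step P i i<ℓ = step-backward P i<ℓ ≤-refl

  reverse : Path G → Path G
  reverse P = reindex P (reverseIndex (len P)) (reverse-step P)

  rotate-step : (P : Path G) (k : ℕ) → suc k ≤ len P → Edge G (vx P 0) (vx P (suc k)) →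
    ∀ i → i < len P → Edge G (vx P (flipPrefix k i)) (vx P (flipPrefix k (suc i)))
  rotate-step P k k<ℓ chord i i<ℓ with <-cmp i k
  ... | tri< i<k _ _ rewrite flipPrefix-≤ (<⇒≤ i<k) | flipPrefix-≤ i<k = step-backward P i<k (<⇒≤ k<ℓ)
  ... | tri≈ _ refl _ rewrite flipPrefix-≤ (≤-refl {i}) | n∸n≡0 i | flipPrefix-> (≤-refl {suc i}) = chord
  ... | tri> _ _ k<i rewrite flipPrefix-> k<i | flipPrefix-> (m<n⇒m<1+n k<i) = step P i i<ℓ

  -- Pósa rotation: v_k … v₁ v₀ v_{k+1} … v_ℓ.
  rotate : (P : Path G) (k : ℕ) → suc k ≤ len P → Edge G (vx P 0) (vx P (suc k)) → Path G
  rotate P k k<ℓ chord = reindex P (flipPrefixIndex k (<⇒≤ k<ℓ)) (rotate-step P k k<ℓ chord)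

  rotate-vx : ∀ (P : Path G) k k<ℓ chord {i} → k < i → vx (rotate P k k<ℓ chord) i ≡ vx P i
  rotate-vx P k k<ℓ chord k<i = cong (vx P) (flipPrefix-> k<i)

  onPath-rotate⁻ : ∀ (P : Path G) k k<ℓ chord {x} → OnPath (rotate P k k<ℓ chord) x → OnPath P x
  onPath-rotate⁻ P k k<ℓ chord = onPath-reindex⁻ P (flipPrefixIndex k (<⇒≤ k<ℓ)) (rotate-step P k k<ℓ chord)

  onPath-reverse⁻ : ∀ (P : Path G) {x} → OnPath (reverse P) x → OnPath P x
  onPath-reverse⁻ P = onPath-reindex⁻ P (reverseIndex (len P)) (reverse-step P)

  onPath-reverse⁺ : ∀ (P : Path G) {x} → OnPath P x → OnPath (reverse P) x
  onPath-reverse⁺ P = onPath-reindex⁺ P (reverseIndex (len P)) (reverse-step P)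

  InL-reverse⁺ : ∀ (P : Path G) i {x} → InL P (len P ∸ i) x → InL (reverse P) i x
  InL-reverse⁺ P i (e , x∉P) = e , x∉P ∘ onPath-reverse⁻ P

  InL-reverse⁻ : ∀ (P : Path G) i {x} → InL (reverse P) i x → InL P (len P ∸ i) x
  InL-reverse⁻ P i (e , x∉P) = e , x∉P ∘ onPath-reverse⁺ P

  _◂_ : Fin n → (ℕ → Fin n) → ℕ → Fin n
  (x ◂ f) zero    = x
  (x ◂ f) (suc i) = f i

  cons : (x : Fin n) (P : Path G) → Edge G x (vx P 0) → ¬ OnPath P x → Path G
  cons x P x~v₀ x∉P = record { len = suc (len P) ; vx = x ◂ vx P ; step = step′ ; inj = inj′ }
    where
      step′ : ∀ i → i < suc (len P) → Edge G ((x ◂ vx P) i) ((x ◂ vx P) (suc i))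
      step′ zero    _         = x~v₀
      step′ (suc i) (s≤s i<ℓ) = step P i i<ℓ
      inj′ : ∀ i j → i ≤ suc (len P) → j ≤ suc (len P) → (x ◂ vx P) i ≡ (x ◂ vx P) j → i ≡ j
      inj′ zero    zero    _         _         _  = refl
      inj′ zero    (suc j) _         (s≤s j≤ℓ) eq = ⊥-elim (x∉P (j , j≤ℓ , sym eq))
      inj′ (suc i) zero    (s≤s i≤ℓ) _         eq = ⊥-elim (x∉P (i , i≤ℓ , eq))
      inj′ (suc i) (suc j) (s≤s i≤ℓ) (s≤s j≤ℓ) eq = cong suc (inj P i j i≤ℓ j≤ℓ eq)

  replaceStart : (x : Fin n) (P : Path G) → Edge G x (vx P 1) → ¬ OnPath P x → Path G
  replaceStart x P x~v₁ x∉P = record { len = len P ; vx = x ◂ (vx P ∘ suc) ; step = step′ ; inj = inj′ }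
    where
      step′ : ∀ i → i < len P → Edge G ((x ◂ (vx P ∘ suc)) i) ((x ◂ (vx P ∘ suc)) (suc i))
      step′ zero    _   = x~v₁
      step′ (suc i) i<ℓ = step P (suc i) i<ℓ
      inj′ : ∀ i j → i ≤ len P → j ≤ len P → (x ◂ (vx P ∘ suc)) i ≡ (x ◂ (vx P ∘ suc)) j → i ≡ j
      inj′ zero    zero    _   _   _  = refl
      inj′ zero    (suc j) _   j≤ℓ eq = ⊥-elim (x∉P (suc j , j≤ℓ , sym eq))
      inj′ (suc i) zero    i≤ℓ _   eq = ⊥-elim (x∉P (suc i , i≤ℓ , eq))
      inj′ (suc i) (suc j) i≤ℓ j≤ℓ eq = inj P (suc i) (suc j) i≤ℓ j≤ℓ eq

  replaceStart-vx : ∀ x (P : Path G) x~v₁ x∉P i → 1 ≤ i → vx (replaceStart x P x~v₁ x∉P) i ≡ vx P i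
  replaceStart-vx x P x~v₁ x∉P (suc i) _ = refl

  longest⇒L₀-empty : ∀ (P : Path G) → Longest P → ∀ x → ¬ InL P 0 x
  longest⇒L₀-empty P longest x (v₀~x , x∉P) = 1+n≰n (longest (cons x P (Edge-sym G v₀~x) x∉P))

  longest⇒start-neighbour-on-path : ∀ (P : Path G) → Longest P → ∀ {y} → Edge G (vx P 0) y → OnPath P y
  longest⇒start-neighbour-on-path P longest {y} v₀~y =
    decidable-stable (onPath? P y) (λ y∉P → longest⇒L₀-empty P longest y (v₀~y , y∉P))

  chosen⇒start-deg-minimal : ∀ (P : Path G) → ChosenPath G P → (Q : Path G) → len Q ≡ len P →
    vx Q (len Q) ≡ vx P (len P) → deg G (vx P 0) ≤ deg G (vx Q 0)
  chosen⇒start-deg-minimal P (_ , minimal) Q len≡ end≡ =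
    +-cancelʳ-≤ _ _ _ (subst (λ w → deg G (vx P 0) + deg G (vx P (len P)) ≤ deg G (vx Q 0) + deg G w)
                             end≡ (minimal Q len≡))

  chosen-reverse : ∀ (P : Path G) → ChosenPath G P → ChosenPath G (reverse P)
  chosen-reverse P (longest , minimal) = longest , minimalᴿ
    where
      minimalᴿ : ∀ Q → len Q ≡ len P →
        deg G (vx P (len P)) + deg G (vx P (len P ∸ len P)) ≤ deg G (vx Q 0) + deg G (vx Q (len Q))
      minimalᴿ Q len≡ rewrite n∸n≡0 (len P) | +-comm (deg G (vx P (len P))) (deg G (vx P 0)) = minimal Q len≡

  start-chord⇒Y : (Q : Path G) (k : ℕ) → 6 + k ≤ len Q → Edge G (vx Q 0) (vx Q (4 + k)) → HasYSubgraph G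
  start-chord⇒Y Q k 6+k≤ℓ chord =
    vx Q ∘ index , injective ,
    Edge-sym G (step Q (3 + k) (≤-trans (m≤n+m _ 2) 6+k≤ℓ)) ,
    step Q (4 + k) (≤-trans (m≤n+m _ 1) 6+k≤ℓ) ,
    Edge-sym G chord ,
    Edge-sym G (step Q (2 + k) (≤-trans (m≤n+m _ 3) 6+k≤ℓ)) ,
    step Q (5 + k) 6+k≤ℓ ,
    step Q 0 (≤-trans (s≤s z≤n) 6+k≤ℓ)
    where
      index : Fin 7 → ℕ
      index f0                               = 4 + k
      index (fs f0)                          = 3 + k
      index (fs (fs f0))                     = 5 + k
      index (fs (fs (fs f0)))                = 0
      index (fs (fs (fs (fs f0))))           = 2 + k
      index (fs (fs (fs (fs (fs f0)))))      = 6 + k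
      index (fs (fs (fs (fs (fs (fs f0)))))) = 1

      decodeFrom2+k : ℕ → Fin 7
      decodeFrom2+k 0 = fs (fs (fs (fs f0)))
      decodeFrom2+k 1 = fs f0
      decodeFrom2+k 2 = f0
      decodeFrom2+k 3 = fs (fs f0)
      decodeFrom2+k _ = fs (fs (fs (fs (fs f0))))

      decode : ℕ → Fin 7
      decode 0             = fs (fs (fs f0))
      decode 1             = fs (fs (fs (fs (fs (fs f0)))))
      decode (suc (suc m)) = decodeFrom2+k (m ∸ k)

      decode-index : ∀ i → decode (index i) ≡ i
      decode-index f0                               rewrite m+n∸n≡m 2 k = refl
      decode-index (fs f0)                          rewrite m+n∸n≡m 1 k = refl
      decode-index (fs (fs f0))                     rewrite m+n∸n≡m 3 k = refl
      decode-index (fs (fs (fs f0)))                = refl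
      decode-index (fs (fs (fs (fs f0))))           rewrite n∸n≡0 k     = refl
      decode-index (fs (fs (fs (fs (fs f0)))))      rewrite m+n∸n≡m 4 k = refl
      decode-index (fs (fs (fs (fs (fs (fs f0)))))) = refl

      index≤ℓ : ∀ i → index i ≤ len Q
      index≤ℓ f0                               = ≤-trans (m≤n+m _ 2) 6+k≤ℓ
      index≤ℓ (fs f0)                          = ≤-trans (m≤n+m _ 3) 6+k≤ℓ
      index≤ℓ (fs (fs f0))                     = ≤-trans (m≤n+m _ 1) 6+k≤ℓ
      index≤ℓ (fs (fs (fs f0)))                = z≤n
      index≤ℓ (fs (fs (fs (fs f0))))           = ≤-trans (m≤n+m _ 4) 6+k≤ℓ
      index≤ℓ (fs (fs (fs (fs (fs f0)))))      = 6+k≤ℓ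
      index≤ℓ (fs (fs (fs (fs (fs (fs f0)))))) = ≤-trans (s≤s z≤n) 6+k≤ℓ

      injective : ∀ i j → vx Q (index i) ≡ vx Q (index j) → i ≡ j
      injective i j eq = trans (sym (decode-index i))
        (trans (cong decode (inj Q _ _ (index≤ℓ i) (index≤ℓ j) eq)) (decode-index j))

module Chord₀₃ {n} {G : Graph n} (P : Path G) (chosen : ChosenPath G P) (5≤ℓ : 5 ≤ len P)
               (v₀~v₃ : Edge G (vx P 0) (vx P 3)) where

  private
    ℓ : ℕ
    ℓ = len P

    v : ℕ → Fin n
    v = vx P

    longest : Longest P
    longest = proj₁ chosen

    index≤ℓ : ∀ i → {T (i ≤ᵇ 5)} → i ≤ ℓ
    index≤ℓ i {i≤5} = ≤-trans (≤ᵇ⇒≤ i 5 i≤5) 5≤ℓ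

    R : Path G
    R = rotate P 2 (index≤ℓ 3) v₀~v₃

    ∉R : ∀ {x} → ¬ OnPath P x → ¬ OnPath R x
    ∉R x∉P = x∉P ∘ onPath-rotate⁻ P 2 (index≤ℓ 3) v₀~v₃

  L₀-empty : ∀ x → ¬ InL P 0 x
  L₀-empty = longest⇒L₀-empty P longest

  L₂-empty : ∀ x → ¬ InL P 2 x
  L₂-empty x (v₂~x , x∉P) = longest⇒L₀-empty R longest x (v₂~x , ∉R x∉P)

  Lℓ-empty : ∀ x → ¬ InL P ℓ x
  Lℓ-empty x (vℓ~x , x∉P) = longest⇒L₀-empty (reverse P) longest x (vℓ~x , x∉P ∘ onPath-reverse⁻ P)

  L₁⊆L₃ : ¬ HasYSubgraph G → (∀ x → ¬ (InL P 1 x × InL P (ℓ ∸ 1) x)) → ∀ x → InL P 1 x → InL P 3 x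
  L₁⊆L₃ noY disjoint x x∈L₁@(v₁~x , x∉P) = v₃~x , x∉P
    where
      Q : Path G
      Q = replaceStart x R (Edge-sym G v₁~x) (∉R x∉P)

      Q-end : vx Q ℓ ≡ v ℓ
      Q-end = trans (replaceStart-vx x R (Edge-sym G v₁~x) (∉R x∉P) ℓ (index≤ℓ 1))
                    (rotate-vx P 2 (index≤ℓ 3) v₀~v₃ (index≤ℓ 3))

      v₁≢v₃ : v 1 ≢ v 3
      v₁≢v₃ eq with () ← inj P 1 3 (index≤ℓ 1) (index≤ℓ 3) eq

      2≤deg-x : 2 ≤ deg G x
      2≤deg-x = ≤-trans (2≤deg G (step P 0 (index≤ℓ 1)) v₀~v₃ v₁≢v₃)
                        (chosen⇒start-deg-minimal P chosen Q refl Q-end)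

      neighbour-is-v₃ : ∀ {z} → Edge G x z → z ≢ v 1 → OnPath Q z → Edge G (v 3) x
      neighbour-is-v₃ x~x  _    (0 , _ , refl) = ⊥-elim (Edge-irrefl G x~x)
      neighbour-is-v₃ _    z≢v₁ (1 , _ , refl) = ⊥-elim (z≢v₁ refl)
      neighbour-is-v₃ x~v₀ _    (2 , _ , refl) = ⊥-elim (L₀-empty x (Edge-sym G x~v₀ , x∉P))
      neighbour-is-v₃ x~v₃ _    (3 , _ , refl) = Edge-sym G x~v₃
      neighbour-is-v₃ x~vj _    (suc (suc (suc (suc k))) , j≤ℓ , refl) with 6 + k ≤? ℓ
      ... | yes 6+k≤ℓ = ⊥-elim (noY (start-chord⇒Y Q k 6+k≤ℓ x~vj))
      ... | no  6+k≰ℓ with ℓ ≟ 4 + k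
      ...   | yes ℓ≡4+k = ⊥-elim (Lℓ-empty x (vℓ~x , x∉P))
        where
          vℓ~x : Edge G (v ℓ) x
          vℓ~x = subst (λ i → Edge G (v i) x) (sym ℓ≡4+k) (Edge-sym G x~vj)
      ...   | no  ℓ≢4+k = ⊥-elim (disjoint x (x∈L₁ , vℓ∸1~x , x∉P))
        where
          ℓ≡5+k : ℓ ≡ 5 + k
          ℓ≡5+k = ≤-antisym (≤-pred (≰⇒> 6+k≰ℓ)) (≤∧≢⇒< j≤ℓ (ℓ≢4+k ∘ sym))
          vℓ∸1~x : Edge G (v (ℓ ∸ 1)) x
          vℓ∸1~x = subst (λ i → Edge G (v i) x) (cong (_∸ 1) (sym ℓ≡5+k)) (Edge-sym G x~vj)

      v₃~x : Edge G (v 3) x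
      v₃~x with 2≤deg⇒neighbour≢ G x 2≤deg-x (v 1)
      ... | y , x~y , y≢v₁ = neighbour-is-v₃ x~y y≢v₁ (longest⇒start-neighbour-on-path Q longest x~y)

lemma3p8 : ∀ {n} (G : Graph n) → Connected G → ¬ HasYSubgraph G →
    (P : Path G) → ChosenPath G P → 5 ≤ len P →
    ¬ Edge G (vx P 0) (vx P (len P ∸ 1)) →
    ¬ Edge G (vx P 0) (vx P (len P)) →
    ¬ Edge G (vx P 1) (vx P (len P ∸ 1)) →
    ¬ Edge G (vx P 1) (vx P (len P)) →
    (∀ x → ¬ (InL P 1 x × InL P (len P ∸ 1) x)) →
    (Edge G (vx P 0) (vx P 3) →
       (∀ x → ¬ InL P 0 x) × (∀ x → ¬ InL P 2 x) × (∀ x → InL P 1 x → InL P 3 x)) ×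
    (Edge G (vx P (len P ∸ 3)) (vx P (len P)) →
       (∀ x → ¬ InL P (len P ∸ 2) x) × (∀ x → ¬ InL P (len P) x) ×
       (∀ x → InL P (len P ∸ 1) x → InL P (len P ∸ 3) x))
lemma3p8 G _ noY P chosen 5≤ℓ _ _ _ _ disjoint =
  (λ v₀~v₃ → let open Chord₀₃ P chosen 5≤ℓ v₀~v₃ in
     L₀-empty , L₂-empty , L₁⊆L₃ noY disjoint) ,
  (λ vℓ∸3~vℓ → let open Chord₀₃ (reverse P) (chosen-reverse P chosen) 5≤ℓ (Edge-sym G vℓ∸3~vℓ) in
     (λ x → L₂-empty x ∘ InL-reverse⁺ P 2) ,
     (λ x → L₀-empty x ∘ InL-reverse⁺ P 0) ,
     (λ x → InL-reverse⁻ P 3 ∘ L₁⊆L₃ noY disjointᴿ x ∘ InL-reverse⁺ P 1))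
  where
    disjointᴿ : ∀ x → ¬ (InL (reverse P) 1 x × InL (reverse P) (len P ∸ 1) x)
    disjointᴿ x (x∈L₁ᴿ , x∈Lℓ∸1ᴿ) = disjoint x
      (subst (λ i → InL P i x) (m∸[m∸n]≡n (≤-trans (s≤s z≤n) 5≤ℓ)) (InL-reverse⁻ P (len P ∸ 1) x∈Lℓ∸1ᴿ) ,
       InL-reverse⁻ P 1 x∈L₁ᴿ)
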